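{- Let $D$ be a directed cycle whose arcs are colored with colors $1$ and $2$. Then $D$ has a unique bikernel if and only if $D$ contains no monochromatic directed path of length two or longer (i.e., no two consecutive arcs of $D$ have the same color).
   Context: A non-empty set $B\subseteq V(G)$ is a bikernel (by monochromatic paths) of a bicolored digraph $G$ (arcs colored $1$ or $2$) if: (i) for all distinct $u,v\in B$ there is no monochromatic directed $uv$-path (all arcs of the same color); (ii) for every $v\in V(G)\setminus B$ there is a directed path all of whose arcs have color $1$ from $v$ to some vertex of $B$; (iii) for every $v\in V(G)\setminus B$ there is a directed path all of whose arcs have color $2$ from some vertex of $B$ to $v$. Length of a path is its number of arcs. -}

module Defs where

open import Data.Nat using (ℕ; zero; suc)
open import Data.Nat.DivMod using (_%_; m%n<n)
open import Data.Fin using (Fin; toℕ; fromℕ<)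
open import Data.Fin.Subset using (Subset; _∈_; _∉_)
open import Data.List using (List; []; _∷_)
open import Data.List.Relation.Unary.Unique.Propositional using (Unique)
open import Data.Empty using (⊥)
open import Data.Product using (Σ; ∃; _×_; _,_)
open import Relation.Binary.PropositionalEquality using (_≡_; _≢_)

data Colour : Set where
  c1 c2 : Colour

record BiDigraph (n : ℕ) : Set₁ where
  field
    Arc : Fin n → Fin n → Colour → Set
open BiDigraph public

data MonoWalk {n : ℕ} (G : BiDigraph n) (k : Colour) : Fin n → Fin n → Set where
  [] : ∀ {u} → MonoWalk G k u u
  _∷_ : ∀ {u w v} → Arc G u w k → MonoWalk G k w v → MonoWalk G k u v

vertices : ∀ {n} {G : BiDigraph n} {k u v} → MonoWalk G k u v → List (Fin n)
vertices {u = u} [] = u ∷ []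
vertices {u = u} (a ∷ w) = u ∷ vertices w

MonoPath : ∀ {n} → BiDigraph n → Colour → Fin n → Fin n → Set
MonoPath G k u v = Σ (MonoWalk G k u v) (λ w → Unique (vertices w))

IsBikernel : ∀ {n} → BiDigraph n → Subset n → Set
IsBikernel {n} G B =
  (∃ λ v → v ∈ B)
  × (∀ u v → u ∈ B → v ∈ B → u ≢ v → ∀ k → MonoPath G k u v → ⊥)
  × (∀ v → v ∉ B → ∃ λ b → b ∈ B × MonoPath G c1 v b)
  × (∀ v → v ∉ B → ∃ λ b → b ∈ B × MonoPath G c2 b v)

HasUniqueBikernel : ∀ {n} → BiDigraph n → Set
HasUniqueBikernel {n} G =
  ∃ λ B → IsBikernel G B × (∀ B′ → IsBikernel G B′ → B′ ≡ B)

next : ∀ {m} → Fin (suc m) → Fin (suc m)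
next {m} i = fromℕ< (m%n<n (suc (toℕ i)) (suc m))

cycle : ∀ {m} → (Fin (suc m) → Colour) → BiDigraph (suc m)
cycle c = record { Arc = λ u v k → (v ≡ next u) × (c u ≡ k) }

module Submission where

open import Defs
open import Data.Nat using (ℕ; suc; s≤s)
open import Data.Nat.Properties using (1+n≢n)
open import Data.Nat.DivMod using (_%_; n%n≡0; m<n⇒m%n≡m)
open import Data.Fin using (Fin; zero; suc; toℕ; fromℕ; inject₁)
open import Data.Fin.Properties using (toℕ-injective; toℕ<n; toℕ-fromℕ<; toℕ-fromℕ; toℕ-inject₁)
open import Data.Fin.Relation.Unary.Top using (view; ‵fromℕ; ‵inject₁)
open import Data.Fin.Subset using (Subset; _∈_; _∉_)
open import Data.Fin.Subset.Properties using (_∈?_; ⊆-antisym)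
open import Data.Vec using (tabulate; lookup)
open import Data.Vec.Properties using (lookup∘tabulate; lookup⇒[]=; []=⇒lookup)
open import Data.Bool using (Bool; true; false)
open import Data.Sum using (_⊎_; inj₁; inj₂)
open import Data.Empty using (⊥)
open import Data.Product using (∃; _×_; _,_; proj₁; proj₂)
open import Data.List.Relation.Unary.All using ([]; _∷_)
open import Data.List.Relation.Unary.AllPairs using ([]; _∷_)
open import Relation.Nullary using (yes; no; contradiction)
open import Function using (_∘_)
open import Function.Bundles using (_⇔_; mk⇔; Equivalence)
open import Relation.Binary.PropositionalEquality

-- In a bikernel B of a bicoloured directed cycle, a vertex outside B must start a path of
-- colour 1, so its out-arc has colour 1; the vertex before a vertex outside B must end a path
-- of colour 2, so its out-arc has colour 2. Since no arc joins two vertices of B, every vertex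
-- of B is such a predecessor. Hence B is forced to be the set of tails of the arcs of colour 2,
-- and membership in B, hence the colour, alternates along the cycle. Conversely, when the
-- colours alternate every monochromatic walk has at most one arc, and the tails of the arcs
-- of colour 2 form a bikernel.

c1≢c2 : c1 ≢ c2
c1≢c2 ()

≢c1⇒≡c2 : ∀ {k} → k ≢ c1 → k ≡ c2
≢c1⇒≡c2 {c1} k≢c1 = contradiction refl k≢c1
≢c1⇒≡c2 {c2} _    = refl

≢c2⇒≡c1 : ∀ {k} → k ≢ c2 → k ≡ c1
≢c2⇒≡c1 {c1} _    = refl
≢c2⇒≡c1 {c2} k≢c2 = contradiction refl k≢c2

module _ {m : ℕ} where

  next-fromℕ : next (fromℕ m) ≡ zero
  next-fromℕ = toℕ-injective (begin
    toℕ (next (fromℕ m))        ≡⟨ toℕ-fromℕ< _ ⟩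
    suc (toℕ (fromℕ m)) % suc m ≡⟨ cong (λ x → suc x % suc m) (toℕ-fromℕ m) ⟩
    suc m % suc m               ≡⟨ n%n≡0 (suc m) ⟩
    0                           ∎)
    where open ≡-Reasoning

  next-inject₁ : (j : Fin m) → next (inject₁ j) ≡ suc j
  next-inject₁ j = toℕ-injective (begin
    toℕ (next (inject₁ j))         ≡⟨ toℕ-fromℕ< _ ⟩
    suc (toℕ (inject₁ j)) % suc m  ≡⟨ cong (λ x → suc x % suc m) (toℕ-inject₁ j) ⟩
    suc (toℕ j) % suc m            ≡⟨ m<n⇒m%n≡m (s≤s (toℕ<n j)) ⟩
    suc (toℕ j)                    ∎)
    where open ≡-Reasoning

  prev : Fin (suc m) → Fin (suc m)
  prev zero    = fromℕ m
  prev (suc j) = inject₁ j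

  next-prev : (i : Fin (suc m)) → next (prev i) ≡ i
  next-prev zero    = next-fromℕ
  next-prev (suc j) = next-inject₁ j

  prev-next : (i : Fin (suc m)) → prev (next i) ≡ i
  prev-next i with view i
  ... | ‵fromℕ     = cong prev next-fromℕ
  ... | ‵inject₁ j = cong prev (next-inject₁ j)

next-irrefl : ∀ {m} (i : Fin (suc (suc m))) → i ≢ next i
next-irrefl i with view i
... | ‵fromℕ     = λ eq → contradiction (trans eq next-fromℕ) λ ()
... | ‵inject₁ j = λ eq → 1+n≢n (sym (begin
    toℕ (inject₁ j)        ≡⟨ cong toℕ eq ⟩
    toℕ (next (inject₁ j)) ≡⟨ cong toℕ (next-inject₁ j) ⟩
    suc (toℕ j)            ≡⟨ cong suc (toℕ-inject₁ j) ⟨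
    suc (toℕ (inject₁ j))  ∎))
  where open ≡-Reasoning

Alternating : ∀ {m} → (Fin (suc m) → Colour) → Set
Alternating c = ∀ i → c i ≢ c (next i)

module _ {m : ℕ} {c : Fin (suc m) → Colour} where

  walk-head-colour : ∀ {k u v} → MonoWalk (cycle c) k u v → u ≢ v → c u ≡ k
  walk-head-colour []            u≢u = contradiction refl u≢u
  walk-head-colour ((_ , e) ∷ _) _   = e

  walk-last-colour : ∀ {k u w v} → Arc (cycle c) u w k → MonoWalk (cycle c) k w v →
                     c (prev v) ≡ k
  walk-last-colour {k} {u} (refl , e) [] = subst (λ x → c x ≡ k) (sym (prev-next u)) e
  walk-last-colour _ (a ∷ w) = walk-last-colour a w

  alternating-walk-short : Alternating c → ∀ {k u v} → MonoWalk (cycle c) k u v →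
                           u ≡ v ⊎ v ≡ next u
  alternating-walk-short alt []                = inj₁ refl
  alternating-walk-short alt ((refl , _) ∷ []) = inj₂ refl
  alternating-walk-short alt {u = u} ((refl , e) ∷ (refl , e′) ∷ _) =
    contradiction (trans e (sym e′)) (alt u)

  alternating-next : Alternating c → ∀ {i} → c i ≡ c1 → c (next i) ≡ c2
  alternating-next alt {i} ci≡c1 = ≢c1⇒≡c2 λ e → alt i (trans ci≡c1 (sym e))

  alternating-prev : Alternating c → ∀ {i} → c i ≡ c1 → c (prev i) ≡ c2
  alternating-prev alt {i} ci≡c1 =
    ≢c1⇒≡c2 λ e → alt (prev i) (trans e (trans (sym ci≡c1) (cong c (sym (next-prev i)))))

arc-path : ∀ {m} {c : Fin (suc (suc m)) → Colour} {k} u → c u ≡ k →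
           MonoPath (cycle c) k u (next u)
arc-path u e = (refl , e) ∷ [] , (next-irrefl u ∷ []) ∷ [] ∷ []

isColour₂ : Colour → Bool
isColour₂ c1 = false
isColour₂ c2 = true

colour₂Set : ∀ {n} → (Fin n → Colour) → Subset n
colour₂Set c = tabulate (λ v → isColour₂ (c v))

∈colour₂Set⇔ : ∀ {n} (c : Fin n → Colour) {v} → v ∈ colour₂Set c ⇔ c v ≡ c2
∈colour₂Set⇔ c {v} = mk⇔ to from
  where
  lookup-colour₂Set : lookup (colour₂Set c) v ≡ isColour₂ (c v)
  lookup-colour₂Set = lookup∘tabulate (λ x → isColour₂ (c x)) v

  isColour₂⇒≡c2 : ∀ {k} → isColour₂ k ≡ true → k ≡ c2
  isColour₂⇒≡c2 {c2} _ = refl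

  to : v ∈ colour₂Set c → c v ≡ c2
  to v∈ = isColour₂⇒≡c2 (trans (sym lookup-colour₂Set) ([]=⇒lookup v∈))

  from : c v ≡ c2 → v ∈ colour₂Set c
  from e = lookup⇒[]= v _ (trans lookup-colour₂Set (cong isColour₂ e))

module Bikernel {m : ℕ} {c : Fin (suc (suc m)) → Colour} {B : Subset (suc (suc m))}
                (isBikernel : IsBikernel (cycle c) B) where

  private
    independent : ∀ u v → u ∈ B → v ∈ B → u ≢ v → ∀ k → MonoPath (cycle c) k u v → ⊥
    independent = proj₁ (proj₂ isBikernel)

    absorbing₁ : ∀ v → v ∉ B → ∃ λ b → b ∈ B × MonoPath (cycle c) c1 v b
    absorbing₁ = proj₁ (proj₂ (proj₂ isBikernel))

    dominating₂ : ∀ v → v ∉ B → ∃ λ b → b ∈ B × MonoPath (cycle c) c2 b v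
    dominating₂ = proj₂ (proj₂ (proj₂ isBikernel))

    ∈≢∉ : ∀ {u v} → u ∈ B → v ∉ B → u ≢ v
    ∈≢∉ u∈B v∉B refl = v∉B u∈B

  ∈⇒next∉ : ∀ {i} → i ∈ B → next i ∉ B
  ∈⇒next∉ {i} i∈B next∈B =
    independent i (next i) i∈B next∈B (next-irrefl i) (c i) (arc-path i refl)

  ∉⇒colour₁ : ∀ {i} → i ∉ B → c i ≡ c1
  ∉⇒colour₁ {i} i∉B with absorbing₁ i i∉B
  ... | b , b∈B , (w , _) = walk-head-colour w (λ i≡b → ∈≢∉ b∈B i∉B (sym i≡b))

  ∉⇒prev-colour₂ : ∀ {v} → v ∉ B → c (prev v) ≡ c2
  ∉⇒prev-colour₂ {v} v∉B with dominating₂ v v∉B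
  ... | b , b∈B , ([] , _)    = contradiction b∈B v∉B
  ... | b , b∈B , (a ∷ w , _) = walk-last-colour a w

  ∈⇒colour₂ : ∀ {i} → i ∈ B → c i ≡ c2
  ∈⇒colour₂ {i} i∈B = subst (λ x → c x ≡ c2) (prev-next i) (∉⇒prev-colour₂ (∈⇒next∉ i∈B))

  ∈⇔colour₂ : ∀ {i} → i ∈ B ⇔ c i ≡ c2
  ∈⇔colour₂ {i} = mk⇔ ∈⇒colour₂ from
    where
    from : c i ≡ c2 → i ∈ B
    from ci≡c2 with i ∈? B
    ... | yes i∈B = i∈B
    ... | no  i∉B = contradiction (trans (sym (∉⇒colour₁ i∉B)) ci≡c2) λ ()

  ≡colour₂Set : B ≡ colour₂Set c
  ≡colour₂Set = ⊆-antisym (λ i∈B → Equivalence.from (∈colour₂Set⇔ c) (∈⇒colour₂ i∈B))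
                          (λ i∈ → Equivalence.from ∈⇔colour₂ (Equivalence.to (∈colour₂Set⇔ c) i∈))

  alternating : Alternating c
  alternating i ci≡cnext with i ∈? B
  ... | yes i∈B = c1≢c2 (begin
    c1         ≡⟨ ∉⇒colour₁ (∈⇒next∉ i∈B) ⟨
    c (next i) ≡⟨ ci≡cnext ⟨
    c i        ≡⟨ ∈⇒colour₂ i∈B ⟩
    c2         ∎)
    where open ≡-Reasoning
  ... | no i∉B = c1≢c2 (begin
    c1                ≡⟨ ∉⇒colour₁ i∉B ⟨
    c i               ≡⟨ cong c (prev-next i) ⟨
    c (prev (next i)) ≡⟨ ∉⇒prev-colour₂ next∉B ⟩
    c2                ∎)
    where
    open ≡-Reasoning
    next∉B : next i ∉ B
    next∉B next∈B = c1≢c2 (trans (sym (∉⇒colour₁ i∉B)) (trans ci≡cnext (∈⇒colour₂ next∈B)))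

module _ {m : ℕ} {c : Fin (suc (suc m)) → Colour} (alt : Alternating c) where

  private
    colour₂⇒∈ : ∀ {v} → c v ≡ c2 → v ∈ colour₂Set c
    colour₂⇒∈ = Equivalence.from (∈colour₂Set⇔ c)

    ∈⇒colour₂ : ∀ {v} → v ∈ colour₂Set c → c v ≡ c2
    ∈⇒colour₂ = Equivalence.to (∈colour₂Set⇔ c)

    ∉colour₂Set⇒colour₁ : ∀ {v} → v ∉ colour₂Set c → c v ≡ c1
    ∉colour₂Set⇒colour₁ v∉ = ≢c2⇒≡c1 (v∉ ∘ colour₂⇒∈)

  colour₂Set-isBikernel : IsBikernel (cycle c) (colour₂Set c)
  colour₂Set-isBikernel = nonempty , independent , absorbing₁ , dominating₂
    where
    nonempty : ∃ λ v → v ∈ colour₂Set c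
    nonempty = nonempty-by (c zero) refl
      where
      nonempty-by : ∀ k → c zero ≡ k → ∃ λ v → v ∈ colour₂Set c
      nonempty-by c1 e = next zero , colour₂⇒∈ (alternating-next alt e)
      nonempty-by c2 e = zero , colour₂⇒∈ e

    independent : ∀ u v → u ∈ colour₂Set c → v ∈ colour₂Set c → u ≢ v →
                  ∀ k → MonoPath (cycle c) k u v → ⊥
    independent u v u∈ v∈ u≢v _ (w , _) with alternating-walk-short alt w
    ... | inj₁ u≡v  = u≢v u≡v
    ... | inj₂ refl = alt u (trans (∈⇒colour₂ u∈) (sym (∈⇒colour₂ v∈)))

    absorbing₁ : ∀ v → v ∉ colour₂Set c → ∃ λ b → b ∈ colour₂Set c × MonoPath (cycle c) c1 v b
    absorbing₁ v v∉ = next v , colour₂⇒∈ (alternating-next alt cv≡c1) , arc-path v cv≡c1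
      where
      cv≡c1 : c v ≡ c1
      cv≡c1 = ∉colour₂Set⇒colour₁ v∉

    dominating₂ : ∀ v → v ∉ colour₂Set c → ∃ λ b → b ∈ colour₂Set c × MonoPath (cycle c) c2 b v
    dominating₂ v v∉ =
      prev v , colour₂⇒∈ cprev≡c2 ,
      subst (MonoPath (cycle c) c2 (prev v)) (next-prev v) (arc-path (prev v) cprev≡c2)
      where
      cprev≡c2 : c (prev v) ≡ c2
      cprev≡c2 = alternating-prev alt (∉colour₂Set⇒colour₁ v∉)

mainTheorem3 : (m : ℕ) (c : Fin (suc (suc m)) → Colour) →
    HasUniqueBikernel (cycle c) ⇔ (∀ i → c i ≢ c (next i))
mainTheorem3 m c = mk⇔
  (λ (_ , isBikernel , _) → Bikernel.alternating isBikernel)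
  (λ alt → colour₂Set c , colour₂Set-isBikernel alt ,
           λ _ isBikernel → Bikernel.≡colour₂Set isBikernel)
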